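{- Let $\pi$ be a degree sequence of length $n$ (vertex set $V$, $|V|=n$). If $\pi$ has one or more of the following properties, then $\pi$ is ds-reconstruction-forcing: (1) there is no bad vertex or exactly one bad vertex; (2) there is no dull vertex or exactly one dull vertex; (3) there is exactly one vertex which is both bad and dull, and there are exactly two bad degrees; (4) the sum of the degrees of the bad vertices is less than $|V| + (|B| \bmod 2)$, where $B$ is the set of bad vertices.
   Context: All graphs are finite and simple. For a vertex $v$ of a graph $G$, the card $G-v$ is called ds-completable if, for each integer $d$, the vertices having degree $d$ in $G-v$ are either all neighbours of $v$ in $G$ or all non-neighbours of $v$ in $G$. A graph is ds-reconstructible iff it has at least one ds-completable vertex. A degree sequence is ds-reconstruction-forcing iff every graph realizing it is ds-reconstructible (non-graphic sequences are deemed forcing). Relative to a degree sequence (equivalently, a graph realizing it), a degree $d$ is bad if the sequence contains the value $d-1$, and dull if it contains the value $d+1$; a vertex (entry) is bad or dull according as its degree is bad or dull. -}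

module Defs where

open import Data.Nat using (ℕ; zero; suc; _+_; _∸_; _<_; _≤_; _%_; _≡ᵇ_; _≤ᵇ_)
open import Data.Bool using (Bool; true; false; _∧_; _∨_; not; if_then_else_)
open import Data.Fin using (Fin; zero; suc; toℕ; _≟_)
open import Data.Sum using (_⊎_)
open import Data.Product using (∃)
open import Relation.Nullary using (¬_)
open import Relation.Nullary.Decidable using (⌊_⌋)
open import Relation.Binary.PropositionalEquality using (_≡_; _≢_)

count : ∀ {n} → (Fin n → Bool) → ℕ
count {zero}  f = 0
count {suc n} f = (if f zero then 1 else 0) + count (λ i → f (suc i))

sumWhere : ∀ {n} → (Fin n → Bool) → (Fin n → ℕ) → ℕ
sumWhere {zero}  f g = 0
sumWhere {suc n} f g = (if f zero then g zero else 0) + sumWhere (λ i → f (suc i)) (λ i → g (suc i))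

anyFin : ∀ {n} → (Fin n → Bool) → Bool
anyFin {zero}  f = false
anyFin {suc n} f = f zero ∨ anyFin (λ i → f (suc i))

record Graph (n : ℕ) : Set where
  field
    adj    : Fin n → Fin n → Bool
    sym    : ∀ u v → adj u v ≡ adj v u
    irrefl : ∀ v → adj v v ≡ false
open Graph public

deg : ∀ {n} → Graph n → Fin n → ℕ
deg G u = count (adj G u)

-- degree of vertex u (u ≠ v) in the card G - v
degCard : ∀ {n} → Graph n → Fin n → Fin n → ℕ
degCard G v u = count (λ w → not ⌊ w ≟ v ⌋ ∧ adj G u w)

DsCompletable : ∀ {n} → Graph n → Fin n → Set
DsCompletable G v = ∀ (d : ℕ) →
    (∀ u → u ≢ v → degCard G v u ≡ d → adj G v u ≡ true)
  ⊎ (∀ u → u ≢ v → degCard G v u ≡ d → adj G v u ≡ false)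

DsReconstructible : ∀ {n} → Graph n → Set
DsReconstructible G = ∃ λ v → DsCompletable G v

Realizes : ∀ {n} → Graph n → (Fin n → ℕ) → Set
Realizes G π = ∀ i → deg G i ≡ π i

DsReconstructionForcing : ∀ {n} → (Fin n → ℕ) → Set
DsReconstructionForcing {n} π = ∀ (G : Graph n) → Realizes G π → DsReconstructible G

contains : ∀ {n} → (Fin n → ℕ) → ℕ → Bool
contains π m = anyFin (λ i → π i ≡ᵇ m)

isBad : ∀ {n} → (Fin n → ℕ) → ℕ → Bool
isBad π zero    = false
isBad π (suc d) = contains π d

isDull : ∀ {n} → (Fin n → ℕ) → ℕ → Bool
isDull π d = contains π (suc d)

badVertex : ∀ {n} → (Fin n → ℕ) → Fin n → Bool
badVertex π i = isBad π (π i)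

dullVertex : ∀ {n} → (Fin n → ℕ) → Fin n → Bool
dullVertex π i = isDull π (π i)

numBad : ∀ {n} → (Fin n → ℕ) → ℕ
numBad π = count (badVertex π)

numDull : ∀ {n} → (Fin n → ℕ) → ℕ
numDull π = count (dullVertex π)

numBadDull : ∀ {n} → (Fin n → ℕ) → ℕ
numBadDull π = count (λ i → badVertex π i ∧ dullVertex π i)

-- strict upper bound on all entries of π
entryBound : ∀ {n} → (Fin n → ℕ) → ℕ
entryBound π = suc (sumWhere (λ _ → true) π)

numBadDegrees : ∀ {n} → (Fin n → ℕ) → ℕ
numBadDegrees π = count {entryBound π} (λ d → contains π (toℕ d) ∧ isBad π (toℕ d))

sumBad : ∀ {n} → (Fin n → ℕ) → ℕ
sumBad π = sumWhere (badVertex π) π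

Prop1 Prop2 Prop3 Prop4 : ∀ {n} → (Fin n → ℕ) → Set
Prop1 π = numBad π ≤ 1
Prop2 π = numDull π ≤ 1
Prop3 π = numBadDull π ≡ 1 Data.Product.× numBadDegrees π ≡ 2
Prop4 {n} π = sumBad π < n + (numBad π % 2)

module Submission where

-- Call a vertex v of G *obstructed* if some neighbour u and
-- some non-neighbour w of v (both different from v) have the same degree in
-- the card G - v.  By definition, an unobstructed vertex is ds-completable,
-- and obstructedness is decidable, so a graph that is not ds-reconstructible
-- has every vertex obstructed.  In a realization G of π an obstruction
-- (u, w) at v means π u = π w + 1: the neighbour u is a bad vertex and the
-- non-neighbour w is a dull vertex.  Hence, when every vertex is obstructed,
--   (1), (2)  the obstruction at an obstructing bad (dull) vertex yields a
--             second bad (dull) vertex;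
--   (3)       the unique bad-and-dull vertex x together with its obstruction
--             exhibits three distinct bad degrees;
--   (4)       every vertex has a bad neighbour, and a double count of the
--             degree sum of such a "dominating" set B gives
--             n + |B| mod 2 ≤ Σ_{b ∈ B} deg b.

open import Defs renaming (sym to adj-sym)
open import Data.Bool using (Bool; true; false; _∧_; not; if_then_else_)
open import Data.Bool.Properties using (T-≡; ∧-conicalˡ; ∧-conicalʳ)
import Data.Bool.Properties as Bool
open import Data.Empty using (⊥-elim)
open import Data.Fin using (Fin; zero; suc; toℕ; fromℕ<; _≟_)
open import Data.Fin.Properties using (any?; all?; ¬∀⟶∃¬; toℕ-fromℕ<)
open import Data.Nat using (ℕ; zero; suc; _+_; _*_; _≤_; _%_; _≡ᵇ_; z≤n; s≤s; >-nonZero)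
open import Data.Nat.Properties
  using (+-*-semiring; ≤-refl; ≤-reflexive; ≤-trans; ≤-pred; <⇒≱; +-mono-≤; +-suc; m≤m*n;
         ≡ᵇ⇒≡; ≡⇒≡ᵇ; 1+n≢n; suc-injective; module ≤-Reasoning)
import Data.Nat.Properties as ℕ
open import Data.Nat.DivMod using ([m+n]%n≡m%n)
open import Data.Nat.Tactic.RingSolver using (solve-∀)
open import Data.Product using (∃; ∃₂; _×_; _,_; proj₁; proj₂)
open import Data.Sum using (_⊎_; inj₁; inj₂)
open import Function.Bundles using (Equivalence)
open import Relation.Nullary using (¬_; Dec; yes; no)
open import Relation.Nullary.Decidable using (⌊_⌋; _×-dec_; ¬?)
open import Relation.Binary.PropositionalEquality
  using (_≡_; _≢_; refl; sym; trans; cong; cong₂; subst; module ≡-Reasoning)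
open import Algebra.Properties.Semiring.Sum +-*-semiring
  using (sum-syntax; sum-cong-≗; ∑-distrib-+; ∑-comm; *-distribˡ-sum)
open import Algebra.Properties.CommutativeSemigroup ℕ.+-commutativeSemigroup using (x∙yz≈y∙xz)

χ : Bool → ℕ
χ b = if b then 1 else 0

count≡∑ : ∀ {n} (f : Fin n → Bool) → count f ≡ ∑[ i < n ] χ (f i)
count≡∑ {zero}  f = refl
count≡∑ {suc n} f = cong (χ (f zero) +_) (count≡∑ (λ i → f (suc i)))

sumWhere≡∑ : ∀ {n} (f : Fin n → Bool) (g : Fin n → ℕ) → sumWhere f g ≡ ∑[ i < n ] (χ (f i) * g i)
sumWhere≡∑ {zero}  f g = refl
sumWhere≡∑ {suc n} f g = cong₂ _+_ (select (f zero)) (sumWhere≡∑ (λ i → f (suc i)) (λ i → g (suc i)))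
  where
  select : ∀ b → (if b then g zero else 0) ≡ χ b * g zero
  select true  = sym (ℕ.+-identityʳ (g zero))
  select false = refl

∑-mono : ∀ {n} {f g : Fin n → ℕ} → (∀ i → f i ≤ g i) → ∑[ i < n ] f i ≤ ∑[ i < n ] g i
∑-mono {zero}  f≤g = z≤n
∑-mono {suc n} f≤g = +-mono-≤ (f≤g zero) (∑-mono (λ i → f≤g (suc i)))

∑-term : ∀ {n} (f : Fin n → ℕ) j → f j ≤ ∑[ i < n ] f i
∑-term f zero    = ℕ.m≤m+n _ _
∑-term f (suc j) = ≤-trans (∑-term (λ i → f (suc i)) j) (ℕ.m≤n+m _ _)

sumWhere-congʳ : ∀ {n} (f : Fin n → Bool) {g h : Fin n → ℕ} → (∀ i → g i ≡ h i) →
  sumWhere f g ≡ sumWhere f h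
sumWhere-congʳ {zero}  f g≡h = refl
sumWhere-congʳ {suc n} f g≡h =
  cong₂ _+_ (cong (λ x → if f zero then x else 0) (g≡h zero)) (sumWhere-congʳ (λ i → f (suc i)) (λ i → g≡h (suc i)))

sumWhere-term : ∀ {n} (f : Fin n → Bool) (g : Fin n → ℕ) j → f j ≡ true → g j ≤ sumWhere f g
sumWhere-term f g j fj = begin
  g j                         ≡⟨ sym (ℕ.*-identityˡ (g j)) ⟩
  χ true * g j                ≡⟨ cong (λ b → χ b * g j) (sym fj) ⟩
  χ (f j) * g j               ≤⟨ ∑-term (λ i → χ (f i) * g i) j ⟩
  ∑[ i < _ ] (χ (f i) * g i)  ≡⟨ sym (sumWhere≡∑ f g) ⟩
  sumWhere f g                ∎
  where open ≤-Reasoning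

χ-complement : ∀ b → χ b + χ (not b) ≡ 1
χ-complement true  = refl
χ-complement false = refl

χ-select-bound : ∀ b x → 1 ≤ x → χ b * x + χ (not b) ≤ x
χ-select-bound true  x _   = ≤-reflexive (trans (ℕ.+-identityʳ (1 * x)) (ℕ.*-identityˡ x))
χ-select-bound false x 1≤x = 1≤x

∑-ones : ∀ n → ∑[ i < n ] 1 ≡ n
∑-ones zero    = refl
∑-ones (suc n) = cong suc (∑-ones n)

-- Handshake lemma: a symmetric double sum with zero diagonal is even,
-- since every off-diagonal term is counted twice.
∑∑-symmetric-even : ∀ {n} (f : Fin n → Fin n → ℕ) →
  (∀ i j → f i j ≡ f j i) → (∀ i → f i i ≡ 0) →
  ∃ λ m → ∑[ i < n ] ∑[ j < n ] f i j ≡ m + m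
∑∑-symmetric-even {zero}  f symm diag = 0 , refl
∑∑-symmetric-even {suc n} f symm diag
  with ∑∑-symmetric-even (λ i j → f (suc i) (suc j)) (λ i j → symm (suc i) (suc j)) (λ i → diag (suc i))
... | m , inner = row + m , (begin
    (f zero zero + row) + ∑[ i < n ] (f (suc i) zero + ∑[ j < n ] f (suc i) (suc j))
      ≡⟨ cong₂ _+_ (cong (_+ row) (diag zero)) (∑-distrib-+ (λ i → f (suc i) zero) _) ⟩
    row + (∑[ i < n ] f (suc i) zero + ∑[ i < n ] ∑[ j < n ] f (suc i) (suc j))
      ≡⟨ cong₂ (λ c r → row + (c + r)) (sum-cong-≗ (λ i → symm (suc i) zero)) inner ⟩
    row + (row + (m + m))
      ≡⟨ interchange row m ⟩
    (row + m) + (row + m) ∎)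
  where
  open ≡-Reasoning
  row : ℕ
  row = ∑[ j < n ] f zero (suc j)
  interchange : ∀ a b → a + (a + (b + b)) ≡ (a + b) + (a + b)
  interchange = solve-∀

%2-step : ∀ k → (2 + k) % 2 ≡ k % 2
%2-step k = trans (cong (_% 2) (ℕ.+-comm 2 k)) ([m+n]%n≡m%n k 2)

round-up-even : ∀ k m → k ≤ m + m → k + k % 2 ≤ m + m
round-up-even zero          m       _  = z≤n
round-up-even (suc zero)    (suc m) _  rewrite +-suc m m = s≤s (s≤s z≤n)
round-up-even (suc (suc k)) (suc m) le rewrite +-suc m m | %2-step k =
  s≤s (s≤s (round-up-even k m (≤-pred (≤-pred le))))

_∖_ : ∀ {n} → (Fin n → Bool) → Fin n → (Fin n → Bool)
(f ∖ v) w = not ⌊ w ≟ v ⌋ ∧ f w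

count-cong : ∀ {n} {f g : Fin n → Bool} → (∀ i → f i ≡ g i) → count f ≡ count g
count-cong {zero}  f≡g = refl
count-cong {suc n} f≡g = cong₂ _+_ (cong χ (f≡g zero)) (count-cong (λ i → f≡g (suc i)))

≟-suc : ∀ {n} (i v : Fin n) → ⌊ suc i ≟ suc v ⌋ ≡ ⌊ i ≟ v ⌋
≟-suc i v with i ≟ v
... | yes _ = refl
... | no  _ = refl

≟-distinct : ∀ {n} {i v : Fin n} → i ≢ v → ⌊ i ≟ v ⌋ ≡ false
≟-distinct {i = i} {v} i≢v with i ≟ v
... | yes i≡v = ⊥-elim (i≢v i≡v)
... | no  _   = refl

count-remove : ∀ {n} (f : Fin n → Bool) v → count f ≡ χ (f v) + count (f ∖ v)
count-remove {suc n} f zero    = refl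
count-remove {suc n} f (suc v) = begin
  χ (f zero) + count (λ i → f (suc i))
    ≡⟨ cong (χ (f zero) +_) (count-remove (λ i → f (suc i)) v) ⟩
  χ (f zero) + (χ (f (suc v)) + count ((λ i → f (suc i)) ∖ v))
    ≡⟨ x∙yz≈y∙xz (χ (f zero)) (χ (f (suc v))) _ ⟩
  χ (f (suc v)) + (χ (f zero) + count ((λ i → f (suc i)) ∖ v))
    ≡⟨ cong (λ c → χ (f (suc v)) + (χ (f zero) + c))
            (count-cong (λ i → cong (λ b → not b ∧ f (suc i)) (sym (≟-suc i v)))) ⟩
  χ (f (suc v)) + count (f ∖ suc v)
    ∎
  where open ≡-Reasoning

∖-keeps : ∀ {n} (f : Fin n → Bool) {i j} → j ≢ i → (f ∖ i) j ≡ f j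
∖-keeps f j≢i rewrite ≟-distinct j≢i = refl

count-positive : ∀ {n} (f : Fin n → Bool) j → f j ≡ true → 1 ≤ count f
count-positive f j fj rewrite count-remove f j | fj = s≤s z≤n

count-pair : ∀ {n} (f : Fin n → Bool) {i j} → j ≢ i → f i ≡ true → f j ≡ true → 2 ≤ count f
count-pair f {i} {j} j≢i fi fj rewrite count-remove f i | fi =
  s≤s (count-positive (f ∖ i) j (trans (∖-keeps f j≢i) fj))

count-triple : ∀ {n} (f : Fin n → Bool) {i j k} → j ≢ i → k ≢ i → k ≢ j →
  f i ≡ true → f j ≡ true → f k ≡ true → 3 ≤ count f
count-triple f {i} {j} {k} j≢i k≢i k≢j fi fj fk rewrite count-remove f i | fi =
  s≤s (count-pair (f ∖ i) k≢j (trans (∖-keeps f j≢i) fj) (trans (∖-keeps f k≢i) fk))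

count≤1-unique : ∀ {n} (f : Fin n → Bool) {i j} → count f ≤ 1 → f i ≡ true → f j ≡ true → j ≡ i
count≤1-unique f {i} {j} count≤1 fi fj with j ≟ i
... | yes j≡i = j≡i
... | no  j≢i = ⊥-elim (<⇒≱ (s≤s count≤1) (count-pair f j≢i fi fj))

count-witness : ∀ {n} (f : Fin n → Bool) → 1 ≤ count f → ∃ λ x → f x ≡ true
count-witness {suc n} f pos with f zero in f0
... | true  = zero , f0
... | false with count-witness (λ i → f (suc i)) pos
...   | x , fx = suc x , fx

two-marked : ∀ {n} (f : Fin n → Bool) → (∀ v → ∃ λ u → u ≢ v × f u ≡ true) → Fin n → 2 ≤ count f
two-marked f other v with other v
... | u , _ , fu with other u
...   | u′ , u′≢u , fu′ = count-pair f u′≢u fu fu′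

anyFin-witness : ∀ {n} (f : Fin n → Bool) → anyFin f ≡ true → ∃ λ x → f x ≡ true
anyFin-witness {suc n} f any with f zero in f0
... | true  = zero , f0
... | false with anyFin-witness (λ i → f (suc i)) any
...   | x , fx = suc x , fx

anyFin-intro : ∀ {n} (f : Fin n → Bool) j → f j ≡ true → anyFin f ≡ true
anyFin-intro f zero    fj rewrite fj = refl
anyFin-intro f (suc j) fj rewrite anyFin-intro (λ i → f (suc i)) j fj = Bool.∨-zeroʳ (f zero)

module _ {n} (π : Fin n → ℕ) where

  contains-entry : ∀ j → contains π (π j) ≡ true
  contains-entry j = anyFin-intro (λ i → π i ≡ᵇ π j) j (Equivalence.to T-≡ (≡⇒≡ᵇ (π j) (π j) refl))

  contains-witness : ∀ d → contains π d ≡ true → ∃ λ j → π j ≡ d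
  contains-witness d c with anyFin-witness (λ i → π i ≡ᵇ d) c
  ... | j , πj≡ᵇd = j , ≡ᵇ⇒≡ (π j) d (Equivalence.from T-≡ πj≡ᵇd)

  bad-above : ∀ u w → π u ≡ suc (π w) → badVertex π u ≡ true
  bad-above u w πu≡1+πw rewrite πu≡1+πw = contains-entry w

  dull-below : ∀ u w → π u ≡ suc (π w) → dullVertex π w ≡ true
  dull-below u w πu≡1+πw = subst (λ d → contains π d ≡ true) πu≡1+πw (contains-entry u)

  same-degree : (p : ℕ → Bool) → ∀ {i j} → π j ≡ π i → p (π i) ≡ true → p (π j) ≡ true
  same-degree p πj≡πi = subst (λ d → p d ≡ true) (sym πj≡πi)

  -- Each entry is below entryBound π, so it names a point of the range
  -- over which numBadDegrees counts.
  entryIndex : Fin n → Fin (entryBound π)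
  entryIndex j = fromℕ< (s≤s (sumWhere-term (λ _ → true) π j refl))

  toℕ-entryIndex : ∀ j → toℕ (entryIndex j) ≡ π j
  toℕ-entryIndex j = toℕ-fromℕ< (s≤s (sumWhere-term (λ _ → true) π j refl))

  three-bad-degrees : ∀ {i j k} → badVertex π i ≡ true → badVertex π j ≡ true → badVertex π k ≡ true →
    π j ≢ π i → π k ≢ π i → π k ≢ π j → 3 ≤ numBadDegrees π
  three-bad-degrees {i} {j} {k} bi bj bk j≠i k≠i k≠j =
    count-triple badDegree (distinct j≠i) (distinct k≠i) (distinct k≠j)
      (isBadDegree i bi) (isBadDegree j bj) (isBadDegree k bk)
    where
    badDegree : Fin (entryBound π) → Bool
    badDegree d = contains π (toℕ d) ∧ isBad π (toℕ d)
    isBadDegree : ∀ x → badVertex π x ≡ true → badDegree (entryIndex x) ≡ true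
    isBadDegree x bx rewrite toℕ-entryIndex x | contains-entry x = bx
    distinct : ∀ {x y} → π y ≢ π x → entryIndex y ≢ entryIndex x
    distinct {x} {y} πy≢πx same =
      πy≢πx (trans (sym (toℕ-entryIndex y)) (trans (cong toℕ same) (toℕ-entryIndex x)))

module _ {n} (G : Graph n) where

  deg-card : ∀ v u → deg G u ≡ χ (adj G v u) + degCard G v u
  deg-card v u = trans (count-remove (adj G u) v) (cong (λ b → χ b + degCard G v u) (adj-sym G u v))

  -- (u, w) obstructs v: a neighbour u and a non-neighbour w of v having
  -- the same degree in G - v.  This is exactly what DsCompletable forbids.
  Obstructs : Fin n → Fin n → Fin n → Set
  Obstructs v u w = u ≢ v × w ≢ v × adj G v u ≡ true × adj G v w ≡ false × degCard G v u ≡ degCard G v w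

  Obstructed : Fin n → Set
  Obstructed v = ∃₂ (Obstructs v)

  obstructed? : ∀ v → Dec (Obstructed v)
  obstructed? v = any? λ u → any? λ w →
    ¬? (u ≟ v) ×-dec ¬? (w ≟ v) ×-dec (adj G v u Bool.≟ true) ×-dec (adj G v w Bool.≟ false)
      ×-dec (degCard G v u ℕ.≟ degCard G v w)

  -- For each degree d, either some non-neighbour has degree d in G - v (and
  -- then, absent obstructions, every vertex of degree d is a non-neighbour),
  -- or every vertex of degree d in G - v is a neighbour.
  unobstructed⇒completable : ∀ v → ¬ Obstructed v → DsCompletable G v
  unobstructed⇒completable v unobstructed d
    with any? (λ w → ¬? (w ≟ v) ×-dec (degCard G v w ℕ.≟ d) ×-dec (adj G v w Bool.≟ false))
  ... | yes (w , w≢v , card-w , nonadj-w) = inj₂ nonNeighbour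
    where
    nonNeighbour : ∀ u → u ≢ v → degCard G v u ≡ d → adj G v u ≡ false
    nonNeighbour u u≢v card-u with adj G v u in adj-u
    ... | false = refl
    ... | true  = ⊥-elim (unobstructed (u , w , u≢v , w≢v , adj-u , nonadj-w , trans card-u (sym card-w)))
  ... | no noNonNeighbour = inj₁ neighbour
    where
    neighbour : ∀ u → u ≢ v → degCard G v u ≡ d → adj G v u ≡ true
    neighbour u u≢v card-u with adj G v u in adj-u
    ... | true  = refl
    ... | false = ⊥-elim (noNonNeighbour (u , u≢v , card-u , adj-u))

  reconstructible-or-obstructed : DsReconstructible G ⊎ (∀ v → Obstructed v)
  reconstructible-or-obstructed with all? obstructed?
  ... | yes everywhere = inj₂ everywhere
  ... | no  ¬everywhere with ¬∀⟶∃¬ n Obstructed obstructed? ¬everywhere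
  ...   | v , unobstructed = inj₁ (v , unobstructed⇒completable v unobstructed)

  obstruction-step : ∀ {v u w} → Obstructs v u w → deg G u ≡ suc (deg G w)
  obstruction-step {v} {u} {w} (_ , _ , adj-u , nonadj-w , card) = begin
    deg G u                             ≡⟨ deg-card v u ⟩
    χ (adj G v u) + degCard G v u       ≡⟨ cong₂ (λ b c → χ b + c) adj-u card ⟩
    suc (χ false + degCard G v w)       ≡⟨ cong (λ b → suc (χ b + degCard G v w)) (sym nonadj-w) ⟩
    suc (χ (adj G v w) + degCard G v w) ≡⟨ cong suc (sym (deg-card v w)) ⟩
    suc (deg G w)                       ∎
    where open ≡-Reasoning

module _ {n} (G : Graph n) (β : Fin n → Bool) where

  βdeg : Fin n → ℕ
  βdeg v = ∑[ b < n ] (χ (β b) * χ (adj G b v))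

  -- Double counting: the degrees of the β-vertices, summed, count every
  -- vertex once per β-neighbour.
  β-degree-sum : sumWhere β (deg G) ≡ ∑[ v < n ] βdeg v
  β-degree-sum = begin
    sumWhere β (deg G)                                   ≡⟨ sumWhere≡∑ β (deg G) ⟩
    ∑[ b < n ] (χ (β b) * deg G b)                       ≡⟨ sum-cong-≗ edgesAt ⟩
    ∑[ b < n ] ∑[ v < n ] (χ (β b) * χ (adj G b v))      ≡⟨ ∑-comm (λ b v → χ (β b) * χ (adj G b v)) ⟩
    ∑[ v < n ] βdeg v                                    ∎
    where
    open ≡-Reasoning
    edgesAt : ∀ b → χ (β b) * deg G b ≡ ∑[ v < n ] (χ (β b) * χ (adj G b v))
    edgesAt b = trans (cong (χ (β b) *_) (count≡∑ {n} (adj G b))) (*-distribˡ-sum {n} (χ (β b)) _)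

  -- Handshake inside β: the edges with both ends in β are counted twice.
  inner-even : ∃ λ m → ∑[ v < n ] (χ (β v) * βdeg v) ≡ m + m
  inner-even with ∑∑-symmetric-even inside inside-sym inside-diag
    where
    inside : Fin n → Fin n → ℕ
    inside v b = χ (β v) * (χ (β b) * χ (adj G b v))
    inside-sym : ∀ v b → inside v b ≡ inside b v
    inside-sym v b = begin
      χ (β v) * (χ (β b) * χ (adj G b v))   ≡⟨ cong (λ e → χ (β v) * (χ (β b) * χ e)) (adj-sym G b v) ⟩
      χ (β v) * (χ (β b) * χ (adj G v b))   ≡⟨ swap-left (χ (β v)) (χ (β b)) _ ⟩
      χ (β b) * (χ (β v) * χ (adj G v b))   ∎
      where
      open ≡-Reasoning
      swap-left : ∀ x y z → x * (y * z) ≡ y * (x * z)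
      swap-left = solve-∀
    inside-diag : ∀ v → inside v v ≡ 0
    inside-diag v rewrite irrefl G v = trans (cong (χ (β v) *_) (ℕ.*-zeroʳ (χ (β v)))) (ℕ.*-zeroʳ (χ (β v)))
  ... | m , even = m , trans (sum-cong-≗ (λ v → *-distribˡ-sum {n} (χ (β v)) _)) even

  dominating-degree-sum : (∀ v → ∃ λ b → β b ≡ true × adj G v b ≡ true) →
    n + count β % 2 ≤ sumWhere β (deg G)
  dominating-degree-sum dominated = begin
    n + k % 2                 ≡⟨ cong (_+ k % 2) (sym partition) ⟩
    (k + R) + k % 2           ≡⟨ swap-right k R (k % 2) ⟩
    (k + k % 2) + R           ≤⟨ +-mono-≤ (round-up-even k m (≤-trans k≤E (≤-reflexive E≡m+m))) ≤-refl ⟩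
    (m + m) + R               ≡⟨ cong (_+ R) (sym E≡m+m) ⟩
    E + R                     ≤⟨ E+R≤ ⟩
    ∑[ v < n ] βdeg v         ≡⟨ sym β-degree-sum ⟩
    sumWhere β (deg G)        ∎
    where
    open ≤-Reasoning
    k R E m : ℕ
    k = count β
    R = ∑[ v < n ] χ (not (β v))
    E = ∑[ v < n ] (χ (β v) * βdeg v)
    m = proj₁ inner-even
    E≡m+m : E ≡ m + m
    E≡m+m = proj₂ inner-even
    swap-right : ∀ a b c → (a + b) + c ≡ (a + c) + b
    swap-right = solve-∀
    βdeg-positive : ∀ v → 1 ≤ βdeg v
    βdeg-positive v with dominated v
    ... | b , βb , adj-vb = ≤-trans (≤-reflexive (sym edge)) (∑-term (λ b′ → χ (β b′) * χ (adj G b′ v)) b)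
      where
      edge : χ (β b) * χ (adj G b v) ≡ 1
      edge rewrite βb | adj-sym G b v | adj-vb = refl
    partition : k + R ≡ n
    partition = begin-equality
      k + R                                   ≡⟨ cong (_+ R) (count≡∑ β) ⟩
      ∑[ v < n ] χ (β v) + R                  ≡⟨ sym (∑-distrib-+ (λ v → χ (β v)) _) ⟩
      ∑[ v < n ] (χ (β v) + χ (not (β v)))    ≡⟨ sum-cong-≗ (λ v → χ-complement (β v)) ⟩
      ∑[ v < n ] 1                            ≡⟨ ∑-ones n ⟩
      n                                       ∎
    k≤E : k ≤ E
    k≤E = begin
      k                    ≡⟨ count≡∑ β ⟩
      ∑[ v < n ] χ (β v)   ≤⟨ ∑-mono (λ v → m≤m*n (χ (β v)) (βdeg v) {{>-nonZero (βdeg-positive v)}}) ⟩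
      E                    ∎
    E+R≤ : E + R ≤ ∑[ v < n ] βdeg v
    E+R≤ = begin
      E + R                                                 ≡⟨ sym (∑-distrib-+ (λ v → χ (β v) * βdeg v) _) ⟩
      ∑[ v < n ] (χ (β v) * βdeg v + χ (not (β v)))         ≤⟨ ∑-mono (λ v → χ-select-bound (β v) (βdeg v) (βdeg-positive v)) ⟩
      ∑[ v < n ] βdeg v                                     ∎

module EverywhereObstructed {n} (π : Fin n → ℕ) (G : Graph n) (realizes : Realizes G π)
                            (obstructed : ∀ v → Obstructed G v) where

  step : ∀ {v u w} → Obstructs G v u w → π u ≡ suc (π w)
  step {u = u} {w} obs = trans (sym (realizes u)) (trans (obstruction-step G obs) (cong suc (realizes w)))

  badNeighbour : ∀ v → ∃ λ u → u ≢ v × adj G v u ≡ true × badVertex π u ≡ true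
  badNeighbour v with obstructed v
  ... | u , w , obs@(u≢v , _ , adj-u , _) = u , u≢v , adj-u , bad-above π u w (step obs)

  dullOther : ∀ v → ∃ λ w → w ≢ v × dullVertex π w ≡ true
  dullOther v with obstructed v
  ... | u , w , obs@(_ , w≢v , _) = w , w≢v , dull-below π u w (step obs)

  ¬Prop1 : Fin n → ¬ Prop1 π
  ¬Prop1 v atMostOne = ℕ.≤⇒≯ atMostOne (two-marked (badVertex π) other v)
    where
    other : ∀ v → ∃ λ u → u ≢ v × badVertex π u ≡ true
    other v with badNeighbour v
    ... | u , u≢v , _ , bad = u , u≢v , bad

  ¬Prop2 : Fin n → ¬ Prop2 π
  ¬Prop2 v atMostOne = ℕ.≤⇒≯ atMostOne (two-marked (dullVertex π) dullOther v)

  badDull : Fin n → Bool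
  badDull i = badVertex π i ∧ dullVertex π i

  -- Let x be the unique bad and dull vertex, obstructed by (u, w).  Neither
  -- u nor w shares the degree of x, so π x, π x + 1 (present as x is dull)
  -- and π u are three different bad degrees.
  ¬Prop3 : ¬ Prop3 π
  ¬Prop3 (oneBadDull , twoBadDegrees)
    with count-witness badDull (≤-reflexive (sym oneBadDull))
  ... | x , bdx with obstructed x | contains-witness π (suc (π x)) (∧-conicalʳ _ _ bdx)
  ...   | u , w , obs@(u≢x , w≢x , _) | y , πy =
    ℕ.<-irrefl refl (subst (3 ≤_) twoBadDegrees
      (three-bad-degrees π (∧-conicalˡ _ _ bdx) (bad-above π y x πy) (bad-above π u w (step obs))
        (λ πy≡πx → 1+n≢n (trans (sym πy) πy≡πx))
        (otherDegree u≢x)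
        (λ πu≡πy → otherDegree w≢x (suc-injective (trans (sym (step obs)) (trans πu≡πy πy))))))
    where
    otherDegree : ∀ {j} → j ≢ x → π j ≢ π x
    otherDegree j≢x πj≡πx =
      j≢x (count≤1-unique badDull (≤-reflexive oneBadDull) bdx
             (same-degree π (λ d → isBad π d ∧ isDull π d) πj≡πx bdx))

  -- The bad vertices dominate G, so their degree sum is too large for (4).
  ¬Prop4 : ¬ Prop4 π
  ¬Prop4 small = ℕ.≤⇒≯ bound small
    where
    bound : n + numBad π % 2 ≤ sumBad π
    bound = subst (n + numBad π % 2 ≤_) (sumWhere-congʳ (badVertex π) (λ i → realizes i))
      (dominating-degree-sum G (badVertex π) dominated)
      where
      dominated : ∀ v → ∃ λ b → badVertex π b ≡ true × adj G v b ≡ true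
      dominated v with badNeighbour v
      ... | u , _ , adj-u , bad = u , bad , adj-u

  no-property : Fin n → ¬ (Prop1 π ⊎ Prop2 π ⊎ Prop3 π ⊎ Prop4 π)
  no-property v (inj₁ p1)               = ¬Prop1 v p1
  no-property v (inj₂ (inj₁ p2))        = ¬Prop2 v p2
  no-property v (inj₂ (inj₂ (inj₁ p3))) = ¬Prop3 p3
  no-property v (inj₂ (inj₂ (inj₂ p4))) = ¬Prop4 p4

lemma4 : ∀ {n : ℕ} → 1 ≤ n → (π : Fin n → ℕ) →
    (Prop1 π ⊎ Prop2 π ⊎ Prop3 π ⊎ Prop4 π) → DsReconstructionForcing π
lemma4 1≤n π property G realizes with reconstructible-or-obstructed G
... | inj₁ reconstructible = reconstructible
... | inj₂ obstructed =
  ⊥-elim (EverywhereObstructed.no-property π G realizes obstructed (fromℕ< 1≤n) property)
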